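{- Let $(G_1,G_2,S)$ be a constrained alignment instance with $m_1=2$ and $m_2=1$. Then for every $t\geq 8$, the fan graph $F_t$ is not an induced subgraph of the conflict graph $\mathcal{C}$.
   Context: Let $G_1=(V_1,E_1)$ and $G_2=(V_2,E_2)$ be finite simple undirected graphs with $V_1\cap V_2=\emptyset$, and let $S$ be a bipartite graph with parts $V_1,V_2$ in which every vertex of $V_1$ has degree at most $m_1$ and every vertex of $V_2$ has degree at most $m_2$; edges of $S$ are similarity edges. A $c_4$ is a 4-cycle $a-b-c-d-a$ in $G_1\cup G_2\cup S$ with $a,b\in V_1$, $c,d\in V_2$, $ab\in E_1$, $cd\in E_2$, $ad,bc\in E(S)$, regarded as a subgraph. Two distinct $c_4$s conflict if their similarity edges cannot all belong to a common matching of $S$. The conflict graph $\mathcal{C}$ has one vertex per $c_4$ and an edge between each pair of conflicting $c_4$s. The fan graph $F_n$ consists of a path $P_n$ on $n$ vertices together with a new vertex adjacent to all vertices of the path. -}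

module Defs where

open import Data.Nat using (ℕ; suc; _≤_; _<_)
open import Data.Fin using (Fin; toℕ)
open import Data.Bool using (Bool; true; false)
open import Data.List using (List; length; filterᵇ; allFin)
open import Data.Product using (Σ; ∃; _×_; _,_)
open import Data.Sum using (_⊎_)
open import Relation.Nullary using (¬_)
open import Relation.Binary.PropositionalEquality using (_≡_; _≢_)

record SimpleGraph (n : ℕ) : Set where
  field
    adj   : Fin n → Fin n → Bool
    sym   : ∀ u v → adj u v ≡ adj v u
    irrefl : ∀ u → adj u u ≡ false
open SimpleGraph public

Bipartite : ℕ → ℕ → Set
Bipartite n₁ n₂ = Fin n₁ → Fin n₂ → Bool

degˡ : ∀ {n₁ n₂} → Bipartite n₁ n₂ → Fin n₁ → ℕ
degˡ {n₁} {n₂} S a = length (filterᵇ (λ v → S a v) (allFin n₂))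

degʳ : ∀ {n₁ n₂} → Bipartite n₁ n₂ → Fin n₂ → ℕ
degʳ {n₁} {n₂} S v = length (filterᵇ (λ a → S a v) (allFin n₁))

record Instance (m₁ m₂ : ℕ) : Set where
  field
    n₁ n₂ : ℕ
    G₁ : SimpleGraph n₁
    G₂ : SimpleGraph n₂
    S  : Bipartite n₁ n₂
    degBound₁ : ∀ a → degˡ S a ≤ m₁
    degBound₂ : ∀ v → degʳ S v ≤ m₂

module _ {m₁ m₂ : ℕ} (I : Instance m₁ m₂) where
  open Instance I

  record C4 : Set where
    constructor c4
    field
      a b : Fin n₁
      c d : Fin n₂
      ab∈E₁ : adj G₁ a b ≡ true
      cd∈E₂ : adj G₂ c d ≡ true
      ad∈S  : S a d ≡ true
      bc∈S  : S b c ≡ true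

  -- Two quadruples describe the same c4 (as a subgraph) iff they are equal
  -- or related by the reversal (a,b,c,d) ↦ (b,a,d,c) (same edge set).
  SameC4 : C4 → C4 → Set
  SameC4 x y =
    (C4.a x ≡ C4.a y × C4.b x ≡ C4.b y × C4.c x ≡ C4.c y × C4.d x ≡ C4.d y)
    ⊎ (C4.a x ≡ C4.b y × C4.b x ≡ C4.a y × C4.c x ≡ C4.d y × C4.d x ≡ C4.c y)

  record Matching : Set where
    field
      M   : Fin n₁ → Fin n₂ → Bool
      M⊆S : ∀ u v → M u v ≡ true → S u v ≡ true
      disjˡ : ∀ u v v' → M u v ≡ true → M u v' ≡ true → v ≡ v'
      disjʳ : ∀ u u' v → M u v ≡ true → M u' v ≡ true → u ≡ u'

  SimIn : Matching → C4 → Set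
  SimIn 𝓜 x = Matching.M 𝓜 (C4.a x) (C4.d x) ≡ true
            × Matching.M 𝓜 (C4.b x) (C4.c x) ≡ true

  Conflict : C4 → C4 → Set
  Conflict x y = ¬ SameC4 x y × ¬ (Σ Matching λ 𝓜 → SimIn 𝓜 x × SimIn 𝓜 y)

FanAdj : (t : ℕ) → Fin (suc t) → Fin (suc t) → Set
FanAdj t i j =
    (toℕ i < t × toℕ j < t × (suc (toℕ i) ≡ toℕ j ⊎ suc (toℕ j) ≡ toℕ i))
  ⊎ (toℕ i ≡ t × toℕ j ≢ t)
  ⊎ (toℕ j ≡ t × toℕ i ≢ t)

InducedInConflict : ∀ {m₁ m₂} (I : Instance m₁ m₂) (k : ℕ)
                    (HAdj : Fin k → Fin k → Set) → Set
InducedInConflict I k HAdj =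
  Σ (Fin k → C4 I) λ f →
    (∀ i j → i ≢ j → ¬ SameC4 I (f i) (f j))
    × (∀ i j → i ≢ j → (HAdj i j → Conflict I (f i) (f j))
                      × (Conflict I (f i) (f j) → HAdj i j))

module Submission where

-- Since every vertex of V₂ has a single similarity edge, two c4s conflict exactly when
-- they clash: they use different similarity edges at a common vertex of V₁, and each
-- vertex of V₁ carries at most two similarity edges. Let x be the c4 at the apex.
-- If x shares a similarity edge with one of the path vertices 0–3, say P, then x clashes
-- with P at a vertex u away from the shared edge, and every c4 that is compatible with P
-- but conflicts with x must contain P's edge at u; path vertices 5, 6, 7 are such, and two
-- consecutive clashes among c4s sharing an edge force 5 and 7 to be the same c4.
-- Otherwise the clashes along 0–1–2–3 all happen at one vertex of V₁ (the vertices of x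
-- are excluded), so the c4s alternate between its two edges and 0, 3 clash after all.

open import Data.Bool using (Bool; true)
open import Data.Bool.Properties using (T-≡)
open import Data.Empty using (⊥; ⊥-elim)
open import Data.Fin using (Fin; toℕ; fromℕ; #_; _↑ˡ_; _≟_)
open import Data.Fin.Properties using (toℕ-fromℕ; toℕ<n; toℕ≤pred[n]; toℕ-↑ˡ; any?)
open import Data.List using (List; length; filterᵇ; allFin)
open import Data.List.Membership.Propositional using (_∈_)
open import Data.List.Membership.Propositional.Properties using (∈-length; ∈-filter⁺; ∈-allFin)
open import Data.List.Relation.Unary.Any using (here; there; tail)
open import Data.Nat using (ℕ; suc; _+_; _∸_; _≤_; _<_; _≥_; z≤n; s≤s)
open import Data.Nat.Properties
  using (≤-trans; ≤-reflexive; m≤m+n; n≤1+n; m≤n⇒m≤1+n; 1+n≰n; <⇒≤; <⇒≢; <-irrefl; <-asym; <-≤-trans; ≤∧≢⇒<; m+[n∸m]≡n)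
open import Data.Product using (Σ; ∃₂; _×_; _,_; proj₁; proj₂)
open import Data.Sum using (_⊎_; inj₁; inj₂; [_,_]′)
open import Function using (_∘_; Equivalence)
open import Relation.Nullary using (¬_; Dec; yes; no; does; contradiction)
open import Relation.Nullary.Decidable using (_⊎-dec_; T?; dec-true)
open import Relation.Binary.PropositionalEquality using (_≡_; _≢_; refl; sym; trans; cong; subst)

open import Defs hiding (sym)

module _ {A : Set} where

  distinct₂⇒2≤length : ∀ {xs : List A} {x y} → x ∈ xs → y ∈ xs → x ≢ y → 2 ≤ length xs
  distinct₂⇒2≤length (here refl) y∈ x≢y = s≤s (∈-length (tail (x≢y ∘ sym) y∈))
  distinct₂⇒2≤length (there x∈) (here refl) _ = s≤s (∈-length x∈)
  distinct₂⇒2≤length (there x∈) (there y∈) x≢y = m≤n⇒m≤1+n (distinct₂⇒2≤length x∈ y∈ x≢y)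

  distinct₃⇒3≤length : ∀ {xs : List A} {x y z} → x ∈ xs → y ∈ xs → z ∈ xs →
                       x ≢ y → x ≢ z → y ≢ z → 3 ≤ length xs
  distinct₃⇒3≤length (here refl) y∈ z∈ x≢y x≢z y≢z =
    s≤s (distinct₂⇒2≤length (tail (x≢y ∘ sym) y∈) (tail (x≢z ∘ sym) z∈) y≢z)
  distinct₃⇒3≤length (there x∈) (here refl) z∈ _ x≢z y≢z =
    s≤s (distinct₂⇒2≤length x∈ (tail (y≢z ∘ sym) z∈) x≢z)
  distinct₃⇒3≤length (there x∈) (there y∈) (here refl) x≢y _ _ =
    s≤s (distinct₂⇒2≤length x∈ y∈ x≢y)
  distinct₃⇒3≤length (there x∈) (there y∈) (there z∈) x≢y x≢z y≢z =
    m≤n⇒m≤1+n (distinct₃⇒3≤length x∈ y∈ z∈ x≢y x≢z y≢z)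

module _ {n₁ n₂ : ℕ} (S : Bipartite n₁ n₂) where

  degˡ≤2⇒alternate : ∀ {u v₀ v₁ v₂} → degˡ S u ≤ 2 →
                     S u v₀ ≡ true → S u v₁ ≡ true → S u v₂ ≡ true →
                     v₀ ≢ v₁ → v₁ ≢ v₂ → v₀ ≡ v₂
  degˡ≤2⇒alternate {u} {v₀} {v₂ = v₂} deg≤2 e₀ e₁ e₂ v₀≢v₁ v₁≢v₂ with v₀ ≟ v₂
  ... | yes v₀≡v₂ = v₀≡v₂
  ... | no v₀≢v₂ =
    contradiction (≤-trans (distinct₃⇒3≤length (nbr e₀) (nbr e₁) (nbr e₂) v₀≢v₁ v₀≢v₂ v₁≢v₂) deg≤2) 1+n≰n
    where
    nbr : ∀ {v} → S u v ≡ true → v ∈ filterᵇ (S u) (allFin n₂)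
    nbr {v} e = ∈-filter⁺ (T? ∘ S u) (∈-allFin v) (Equivalence.from T-≡ e)

  degʳ≤1⇒unique : ∀ {u u' v} → degʳ S v ≤ 1 → S u v ≡ true → S u' v ≡ true → u ≡ u'
  degʳ≤1⇒unique {u} {u'} {v} deg≤1 e e' with u ≟ u'
  ... | yes u≡u' = u≡u'
  ... | no u≢u' = contradiction (≤-trans (distinct₂⇒2≤length (nbr e) (nbr e') u≢u') deg≤1) 1+n≰n
    where
    nbr : ∀ {w} → S w v ≡ true → w ∈ filterᵇ (λ w → S w v) (allFin n₁)
    nbr {w} e = ∈-filter⁺ (λ w → T? (S w v)) (∈-allFin w) (Equivalence.from T-≡ e)

module _ (I : Instance 2 1) where
  open Instance I
  open C4

  data SimEdge (y : C4 I) (u : Fin n₁) (v : Fin n₂) : Set where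
    ad : u ≡ a y → v ≡ d y → SimEdge y u v
    bc : u ≡ b y → v ≡ c y → SimEdge y u v

  simEdge? : ∀ y u v → Dec (SimEdge y u v)
  simEdge? y u v with u ≟ a y | v ≟ d y | u ≟ b y | v ≟ c y
  ... | yes u≡a | yes v≡d | _       | _       = yes (ad u≡a v≡d)
  ... | _       | _       | yes u≡b | yes v≡c = yes (bc u≡b v≡c)
  ... | no u≢a  | _       | no u≢b  | _       = no λ { (ad u≡a _) → u≢a u≡a ; (bc u≡b _) → u≢b u≡b }
  ... | no u≢a  | _       | yes _   | no v≢c  = no λ { (ad u≡a _) → u≢a u≡a ; (bc _ v≡c) → v≢c v≡c }
  ... | yes _   | no v≢d  | no u≢b  | _       = no λ { (ad _ v≡d) → v≢d v≡d ; (bc u≡b _) → u≢b u≡b }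
  ... | yes _   | no v≢d  | yes _   | no v≢c  = no λ { (ad _ v≡d) → v≢d v≡d ; (bc _ v≡c) → v≢c v≡c }

  simEdge⇒S : ∀ {y u v} → SimEdge y u v → S u v ≡ true
  simEdge⇒S {y} (ad refl refl) = ad∈S y
  simEdge⇒S {y} (bc refl refl) = bc∈S y

  a≢b : ∀ (y : C4 I) → a y ≢ b y
  a≢b y a≡b = contradiction (trans (sym loop) (irrefl G₁ (a y))) λ ()
    where
    loop : adj G₁ (a y) (a y) ≡ true
    loop = subst (λ w → adj G₁ (a y) w ≡ true) (sym a≡b) (ab∈E₁ y)

  simEdge-functional : ∀ {y u v v'} → SimEdge y u v → SimEdge y u v' → v ≡ v'
  simEdge-functional     (ad refl refl) (ad _ refl)   = refl
  simEdge-functional {y} (ad refl refl) (bc a≡b refl) = ⊥-elim (a≢b y a≡b)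
  simEdge-functional {y} (bc refl refl) (ad b≡a refl) = ⊥-elim (a≢b y (sym b≡a))
  simEdge-functional     (bc refl refl) (bc _ refl)   = refl

  simEdge-other-unique : ∀ {y u v p q p' q'} → SimEdge y u v → SimEdge y p q → SimEdge y p' q' →
                         p ≢ u → p' ≢ u → p ≡ p' × q ≡ q'
  simEdge-other-unique (ad refl _) (ad refl _) _ p≢u _ = ⊥-elim (p≢u refl)
  simEdge-other-unique (ad refl _) _ (ad refl _) _ p'≢u = ⊥-elim (p'≢u refl)
  simEdge-other-unique (ad _ _) (bc refl refl) (bc refl refl) _ _ = refl , refl
  simEdge-other-unique (bc refl _) (bc refl _) _ p≢u _ = ⊥-elim (p≢u refl)
  simEdge-other-unique (bc refl _) _ (bc refl _) _ p'≢u = ⊥-elim (p'≢u refl)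
  simEdge-other-unique (bc _ _) (ad refl refl) (ad refl refl) _ _ = refl , refl

  two-simEdges⇒SameC4 : ∀ {y z u v p q} → SimEdge y u v → SimEdge y p q →
                        SimEdge z u v → SimEdge z p q → u ≢ p → SameC4 I y z
  two-simEdges⇒SameC4 (ad refl refl) (ad p≡a _) _ _ u≢p = ⊥-elim (u≢p (sym p≡a))
  two-simEdges⇒SameC4 (bc refl refl) (bc p≡b _) _ _ u≢p = ⊥-elim (u≢p (sym p≡b))
  two-simEdges⇒SameC4 _ _ (ad e₁ _) (ad e₂ _) u≢p = ⊥-elim (u≢p (trans e₁ (sym e₂)))
  two-simEdges⇒SameC4 _ _ (bc e₁ _) (bc e₂ _) u≢p = ⊥-elim (u≢p (trans e₁ (sym e₂)))
  two-simEdges⇒SameC4 (ad refl refl) (bc refl refl) (ad e₁ e₂) (bc e₃ e₄) _ = inj₁ (e₁ , e₃ , e₄ , e₂)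
  two-simEdges⇒SameC4 (ad refl refl) (bc refl refl) (bc e₁ e₂) (ad e₃ e₄) _ = inj₂ (e₁ , e₃ , e₄ , e₂)
  two-simEdges⇒SameC4 (bc refl refl) (ad refl refl) (ad e₁ e₂) (bc e₃ e₄) _ = inj₂ (e₃ , e₁ , e₂ , e₄)
  two-simEdges⇒SameC4 (bc refl refl) (ad refl refl) (bc e₁ e₂) (ad e₃ e₄) _ = inj₁ (e₃ , e₁ , e₂ , e₄)

  Compatible : C4 I → C4 I → Set
  Compatible y z = ∀ {u v v'} → SimEdge y u v → SimEdge z u v' → v ≡ v'

  data Clash (y z : C4 I) : Set where
    clash : ∀ {p q q'} → SimEdge y p q → SimEdge z p q' → q ≢ q' → Clash y z

  data Shares (y z : C4 I) : Set where
    shares : ∀ {u v} → SimEdge y u v → SimEdge z u v → Shares y z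

  shares? : ∀ y z → Dec (Shares y z)
  shares? y z with simEdge? z (a y) (d y) | simEdge? z (b y) (c y)
  ... | yes e | _     = yes (shares (ad refl refl) e)
  ... | no _  | yes e = yes (shares (bc refl refl) e)
  ... | no ¬e₁ | no ¬e₂ = no λ { (shares (ad refl refl) e) → ¬e₁ e ; (shares (bc refl refl) e) → ¬e₂ e }

  clash⊎compatible : ∀ y z → Clash y z ⊎ Compatible y z
  clash⊎compatible y z with compare (ad refl refl) (ad refl refl) | compare (ad refl refl) (bc refl refl)
                          | compare (bc refl refl) (ad refl refl) | compare (bc refl refl) (bc refl refl)
    where
    compare : ∀ {p q p' q'} → SimEdge y p q → SimEdge z p' q' → Clash y z ⊎ (p ≡ p' → q ≡ q')
    compare {p} {q} {p'} {q'} e e' with p ≟ p' | q ≟ q'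
    ... | yes refl | no q≢q' = inj₁ (clash e e' q≢q')
    ... | yes _    | yes q≡q' = inj₂ λ _ → q≡q'
    ... | no p≢p'  | _        = inj₂ (⊥-elim ∘ p≢p')
  ... | inj₁ c | _ | _ | _ = inj₁ c
  ... | _ | inj₁ c | _ | _ = inj₁ c
  ... | _ | _ | inj₁ c | _ = inj₁ c
  ... | _ | _ | _ | inj₁ c = inj₁ c
  ... | inj₂ aa | inj₂ ab | inj₂ ba | inj₂ bb = inj₂ compatible
    where
    compatible : Compatible y z
    compatible (ad refl refl) (ad e refl) = aa e
    compatible (ad refl refl) (bc e refl) = ab e
    compatible (bc refl refl) (ad e refl) = ba e
    compatible (bc refl refl) (bc e refl) = bb e

  CommonMatching : C4 I → C4 I → Set
  CommonMatching y z = Σ (Matching I) λ 𝓜 → SimIn I 𝓜 y × SimIn I 𝓜 z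

  -- Disjointness on the V₂ side is automatic because m₂ = 1.
  compatible⇒commonMatching : ∀ {y z} → Compatible y z → CommonMatching y z
  compatible⇒commonMatching {y} {z} compatible =
    record { M = M ; M⊆S = M⊆S ; disjˡ = disjˡ ; disjʳ = disjʳ }
    , (dec-true (edge? _ _) (inj₁ (ad refl refl)) , dec-true (edge? _ _) (inj₁ (bc refl refl)))
    , (dec-true (edge? _ _) (inj₂ (ad refl refl)) , dec-true (edge? _ _) (inj₂ (bc refl refl)))
    where
    edge? : ∀ u v → Dec (SimEdge y u v ⊎ SimEdge z u v)
    edge? u v = simEdge? y u v ⊎-dec simEdge? z u v
    M : Fin n₁ → Fin n₂ → Bool
    M u v = does (edge? u v)
    edge : ∀ u v → M u v ≡ true → SimEdge y u v ⊎ SimEdge z u v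
    edge u v = witness (edge? u v)
      where
      witness : ∀ {A : Set} (a? : Dec A) → does a? ≡ true → A
      witness (yes a) _ = a
    M⊆S : ∀ u v → M u v ≡ true → S u v ≡ true
    M⊆S u v = [ simEdge⇒S , simEdge⇒S ]′ ∘ edge u v
    disjˡ : ∀ u v v' → M u v ≡ true → M u v' ≡ true → v ≡ v'
    disjˡ u v v' e e' with edge u v e | edge u v' e'
    ... | inj₁ h | inj₁ h' = simEdge-functional h h'
    ... | inj₁ h | inj₂ h' = compatible h h'
    ... | inj₂ h | inj₁ h' = sym (compatible h' h)
    ... | inj₂ h | inj₂ h' = simEdge-functional h h'
    disjʳ : ∀ u u' v → M u v ≡ true → M u' v ≡ true → u ≡ u'
    disjʳ u u' v e e' = degʳ≤1⇒unique S (degBound₂ v) (M⊆S u v e) (M⊆S u' v e')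

  clash⇒¬commonMatching : ∀ {y z} → Clash y z → ¬ CommonMatching y z
  clash⇒¬commonMatching (clash h h' q≢q') (𝓜 , in-y , in-z) =
    q≢q' (Matching.disjˡ 𝓜 _ _ _ (inMatching in-y h) (inMatching in-z h'))
    where
    inMatching : ∀ {w u v} → SimIn I 𝓜 w → SimEdge w u v → Matching.M 𝓜 u v ≡ true
    inMatching (ad∈M , _) (ad refl refl) = ad∈M
    inMatching (_ , bc∈M) (bc refl refl) = bc∈M

  conflict⇒clash : ∀ {y z} → Conflict I y z → Clash y z
  conflict⇒clash {y} {z} (_ , ¬common) with clash⊎compatible y z
  ... | inj₁ c = c
  ... | inj₂ compatible = ⊥-elim (¬common (compatible⇒commonMatching compatible))

  ¬conflict⇒compatible : ∀ {y z} → ¬ SameC4 I y z → ¬ Conflict I y z → Compatible y z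
  ¬conflict⇒compatible {y} {z} ¬same ¬conflict with clash⊎compatible y z
  ... | inj₁ c = ⊥-elim (¬conflict (¬same , clash⇒¬commonMatching c))
  ... | inj₂ compatible = compatible

  clash-avoids-sharedVertex : ∀ {y z u v p q q'} → SimEdge y u v → SimEdge z u v →
                              SimEdge y p q → SimEdge z p q' → q ≢ q' → p ≢ u
  clash-avoids-sharedVertex e e' h h' q≢q' refl =
    q≢q' (trans (simEdge-functional h e) (simEdge-functional e' h'))

  shared-clash-clash⇒SameC4 : ∀ {Q₀ Q₁ Q₂ u v} → SimEdge Q₀ u v → SimEdge Q₁ u v → SimEdge Q₂ u v →
                              Clash Q₀ Q₁ → Clash Q₁ Q₂ → SameC4 I Q₀ Q₂
  shared-clash-clash⇒SameC4 {Q₀} {Q₂ = Q₂} {u} e₀ e₁ e₂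
    (clash {p} {q₀} {q₁} h₀ h₁ q₀≢q₁) (clash {p'} {q₁'} {q₂} h₁' h₂ q₁'≢q₂) =
    conclude (simEdge-other-unique e₁ h₁ h₁' p≢u p'≢u)
    where
    p≢u : p ≢ u
    p≢u = clash-avoids-sharedVertex e₀ e₁ h₀ h₁ q₀≢q₁
    p'≢u : p' ≢ u
    p'≢u = clash-avoids-sharedVertex e₁ e₂ h₁' h₂ q₁'≢q₂
    conclude : p ≡ p' × q₁ ≡ q₁' → SameC4 I Q₀ Q₂
    conclude (refl , refl) = two-simEdges⇒SameC4 e₀ h₀ e₂ (subst (SimEdge Q₂ p) (sym q₀≡q₂) h₂) (p≢u ∘ sym)
      where
      q₀≡q₂ : q₀ ≡ q₂
      q₀≡q₂ = degˡ≤2⇒alternate S (degBound₁ p) (simEdge⇒S h₀) (simEdge⇒S h₁) (simEdge⇒S h₂) q₀≢q₁ q₁'≢q₂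

  ForcedEdge : C4 I → C4 I → Set
  ForcedEdge x P = ∃₂ λ u w → ∀ {Q} → Compatible P Q → Clash x Q → SimEdge Q u w

  shared-clash⇒forcedEdge : ∀ {x P} → Shares x P → Clash x P → ForcedEdge x P
  shared-clash⇒forcedEdge {x} {P} (shares {u₁} sₓ sₚ) (clash {u} {vₓ} {w} hₓ hₚ vₓ≢w) = u , w , forced
    where
    u≢u₁ : u ≢ u₁
    u≢u₁ = clash-avoids-sharedVertex sₓ sₚ hₓ hₚ vₓ≢w
    forced : ∀ {Q} → Compatible P Q → Clash x Q → SimEdge Q u w
    forced {Q} compatible (clash {u'} {vₓ'} hₓ' h vₓ'≢v) =
      conclude (proj₁ (simEdge-other-unique sₓ hₓ' hₓ u'≢u₁ u≢u₁))
      where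
      u'≢u₁ : u' ≢ u₁
      u'≢u₁ refl = vₓ'≢v (trans (simEdge-functional hₓ' sₓ) (compatible sₚ h))
      conclude : u' ≡ u → SimEdge Q u w
      conclude refl = subst (SimEdge Q u) (sym (compatible hₚ h)) h

  unshared-clash-avoids : ∀ {x P P' p q q' vₓ} → ¬ Shares x P → ¬ Shares x P' →
                          SimEdge P p q → SimEdge P' p q' → q ≢ q' → ¬ SimEdge x p vₓ
  unshared-clash-avoids {q = q} {q'} {vₓ} ¬sh ¬sh' h h' q≢q' hₓ =
    q≢q' (degˡ≤2⇒alternate S (degBound₁ _) (simEdge⇒S h) (simEdge⇒S hₓ) (simEdge⇒S h') q≢vₓ vₓ≢q')
    where
    q≢vₓ : q ≢ vₓ
    q≢vₓ refl = ¬sh (shares hₓ h)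
    vₓ≢q' : vₓ ≢ q'
    vₓ≢q' refl = ¬sh' (shares hₓ h')

  unshared-clashes-meet : ∀ {x P₀ P₁ P₂ p q₀ q₁ p' q₁' q₂} →
                          ¬ Shares x P₀ → ¬ Shares x P₁ → ¬ Shares x P₂ → Clash x P₁ →
                          SimEdge P₀ p q₀ → SimEdge P₁ p q₁ → q₀ ≢ q₁ →
                          SimEdge P₁ p' q₁' → SimEdge P₂ p' q₂ → q₁' ≢ q₂ →
                          p ≡ p' × q₁ ≡ q₁'
  unshared-clashes-meet {x} ¬sh₀ ¬sh₁ ¬sh₂ (clash {u} hₓ h _) h₀ h₁ q₀≢q₁ h₁' h₂ q₁'≢q₂ =
    simEdge-other-unique h h₁ h₁' (avoids ¬sh₀ ¬sh₁ h₀ h₁ q₀≢q₁) (avoids ¬sh₁ ¬sh₂ h₁' h₂ q₁'≢q₂)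
    where
    avoids : ∀ {P P' p q q'} → ¬ Shares x P → ¬ Shares x P' → SimEdge P p q → SimEdge P' p q' → q ≢ q' → p ≢ u
    avoids ¬sh ¬sh' h h' q≢q' refl = unshared-clash-avoids ¬sh ¬sh' h h' q≢q' hₓ

  unshared-path⇒¬compatible : ∀ {x P₀ P₁ P₂ P₃} →
                              ¬ Shares x P₀ → ¬ Shares x P₁ → ¬ Shares x P₂ → ¬ Shares x P₃ →
                              Clash x P₁ → Clash x P₂ → Clash P₀ P₁ → Clash P₁ P₂ → Clash P₂ P₃ →
                              ¬ Compatible P₀ P₃
  unshared-path⇒¬compatible ¬sh₀ ¬sh₁ ¬sh₂ ¬sh₃ x₁ x₂
    (clash h₀ h₁ q₀≢q₁) (clash h₁' h₂ q₁≢q₂) (clash h₂' h₃ q₂≢q₃) compatible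
    with unshared-clashes-meet ¬sh₀ ¬sh₁ ¬sh₂ x₁ h₀ h₁ q₀≢q₁ h₁' h₂ q₁≢q₂
       | unshared-clashes-meet ¬sh₁ ¬sh₂ ¬sh₃ x₂ h₁' h₂ q₁≢q₂ h₂' h₃ q₂≢q₃
  ... | refl , refl | refl , refl =
    q₀≢q₁ (trans (compatible h₀ h₃)
                 (sym (degˡ≤2⇒alternate S (degBound₁ _) (simEdge⇒S h₁) (simEdge⇒S h₂) (simEdge⇒S h₃) q₁≢q₂ q₂≢q₃)))

module _ {t : ℕ} where

  path-vertex< : (j : Fin (suc t)) → toℕ j ≢ t → toℕ j < t
  path-vertex< j = ≤∧≢⇒< (toℕ≤pred[n] j)

  fan-apex : {k : Fin (suc t)} → toℕ k ≢ t → FanAdj t (fromℕ t) k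
  fan-apex k≢t = inj₂ (inj₁ (toℕ-fromℕ t , k≢t))

  fan-path : {i j : Fin (suc t)} → suc (toℕ i) ≡ toℕ j → toℕ j ≢ t → FanAdj t i j
  fan-path {i} {j} i+1≡j j≢t = inj₁ (<⇒≤ (subst (_< t) (sym i+1≡j) j<t) , j<t , inj₁ i+1≡j)
    where
    j<t : toℕ j < t
    j<t = path-vertex< j j≢t

  fan-far : {i j : Fin (suc t)} → 2 + toℕ i ≤ toℕ j → toℕ j ≢ t → ¬ FanAdj t i j
  fan-far i+2≤j _   (inj₁ (_ , _ , inj₁ i+1≡j)) = 1+n≰n (subst (2 + _ ≤_) (sym i+1≡j) i+2≤j)
  fan-far i+2≤j _   (inj₁ (_ , _ , inj₂ j+1≡i)) = <-asym (≤-trans (n≤1+n _) i+2≤j) (≤-reflexive j+1≡i)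
  fan-far {j = j} i+2≤j _ (inj₂ (inj₁ (i≡t , _))) =
    <-irrefl i≡t (<-≤-trans (≤-trans (n≤1+n _) i+2≤j) (toℕ≤pred[n] j))
  fan-far _     j≢t (inj₂ (inj₂ (j≡t , _))) = j≢t j≡t

module FanEmbedding (I : Instance 2 1) (t : ℕ) (f : Fin (suc (8 + t)) → C4 I)
  (distinct : ∀ i j → i ≢ j → ¬ SameC4 I (f i) (f j))
  (induced : ∀ i j → i ≢ j → (FanAdj (8 + t) i j → Conflict I (f i) (f j))
                           × (Conflict I (f i) (f j) → FanAdj (8 + t) i j))
  where

  T : ℕ
  T = 8 + t

  apex : C4 I
  apex = f (fromℕ T)

  apex-clash : {k : Fin (suc T)} → toℕ k ≢ T → Clash I apex (f k)
  apex-clash {k} k≢T = conflict⇒clash I (proj₁ (induced _ _ apex≢k) (fan-apex k≢T))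
    where
    apex≢k : fromℕ T ≢ k
    apex≢k refl = k≢T (toℕ-fromℕ T)

  path-clash : {i j : Fin (suc T)} → suc (toℕ i) ≡ toℕ j → toℕ j ≢ T → Clash I (f i) (f j)
  path-clash i+1≡j j≢T =
    conflict⇒clash I (proj₁ (induced _ _ (<⇒≢ (≤-reflexive i+1≡j) ∘ cong toℕ)) (fan-path i+1≡j j≢T))

  far-compatible : {i j : Fin (suc T)} → 2 + toℕ i ≤ toℕ j → toℕ j ≢ T → Compatible I (f i) (f j)
  far-compatible {i} {j} i+2≤j j≢T =
    ¬conflict⇒compatible I (distinct _ _ i≢j) (fan-far i+2≤j j≢T ∘ proj₂ (induced _ _ i≢j))
    where
    i≢j : i ≢ j
    i≢j = <⇒≢ (≤-trans (n≤1+n _) i+2≤j) ∘ cong toℕ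

  SharesApex : Fin 4 → Set
  SharesApex k = Shares I apex (f (k ↑ˡ (5 + t)))

  sharedApex⇒⊥ : (k : Fin 4) → ¬ SharesApex k
  sharedApex⇒⊥ k sharesₖ = conclude (shared-clash⇒forcedEdge I sharesₖ (apex-clash k≢T))
    where
    k' : Fin (suc T)
    k' = k ↑ˡ (5 + t)
    k<4 : toℕ k' < 4
    k<4 = subst (_< 4) (sym (toℕ-↑ˡ k _)) (toℕ<n k)
    k≢T : toℕ k' ≢ T
    k≢T = <⇒≢ (≤-trans k<4 (m≤m+n 4 (4 + t)))
    conclude : ForcedEdge I apex (f k') → ⊥
    conclude (u , w , forced) =
      distinct (# 5) (# 7) (λ ())
        (shared-clash-clash⇒SameC4 I (forcedAt far₅ (λ ())) (forcedAt far₆ (λ ())) (forcedAt far₇ (λ ()))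
          (path-clash refl (λ ())) (path-clash refl (λ ())))
      where
      forcedAt : {j : Fin (suc T)} → 2 + toℕ k' ≤ toℕ j → toℕ j ≢ T → SimEdge I (f j) u w
      forcedAt far j≢T = forced (far-compatible far j≢T) (apex-clash j≢T)
      far₅ : 2 + toℕ k' ≤ 5
      far₅ = s≤s k<4
      far₆ : 2 + toℕ k' ≤ 6
      far₆ = m≤n⇒m≤1+n far₅
      far₇ : 2 + toℕ k' ≤ 7
      far₇ = m≤n⇒m≤1+n far₆

  unsharedApex⇒⊥ : (∀ k → ¬ SharesApex k) → ⊥
  unsharedApex⇒⊥ unshared =
    unshared-path⇒¬compatible I (unshared (# 0)) (unshared (# 1)) (unshared (# 2)) (unshared (# 3))
      (apex-clash (λ ())) (apex-clash (λ ()))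
      (path-clash refl (λ ())) (path-clash refl (λ ())) (path-clash refl (λ ()))
      (far-compatible (s≤s (s≤s z≤n)) (λ ()))

  impossible : ⊥
  impossible with any? (λ k → shares? I apex (f (k ↑ˡ (5 + t))))
  ... | yes (k , sharesₖ) = sharedApex⇒⊥ k sharesₖ
  ... | no none = unsharedApex⇒⊥ (λ k sharesₖ → none (k , sharesₖ))

corollary7 : (I : Instance 2 1) (t : ℕ) → t ≥ 8 →
    ¬ InducedInConflict I (suc t) (FanAdj t)
-- Writing t as 8 + t′ makes the path vertices # 0 … # 7 closed terms.
corollary7 I t 8≤t (f , distinct , induced) with t ∸ 8 | m+[n∸m]≡n 8≤t
... | t' | refl = FanEmbedding.impossible I t' f distinct induced
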